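{- Let $\alpha\ge 2$ be an integer and let $A_\alpha$ be the graph defined below, with $D_\alpha=\{d_S : \varnothing\ne S\subseteq\{1,\dots,\alpha-1\}\}$. Let $C$ be a minimal $d_\alpha$-$D_\alpha$ cut in $A_\alpha$ with $C\ne\{d_\alpha\}$. Then for each nonempty $S\subset\{1,\dots,\alpha-1\}$ all of the following hold: (a) If $d_S\notin C$, then $d_T\notin C$ for every nonempty $T\subset S$. (b) If $x_{S\cup\{\alpha\}}\notin C$, then $x_{T\cup\{\alpha\}}\notin C$ for every nonempty $T\subset S$. (c) If $d_S\notin C$, and $x_{T\cup\{\alpha\}}\notin C$ for some nonempty $T\subseteq\{1,\dots,\alpha-1\}$, then $x_R\in C$ for every $R\subseteq\{1,\dots,\alpha-1\}$ with $R\cap S\ne\varnothing\ne R\cap T$ and $|R|\ge 2$. (d) $d_S\notin C$ if and only if $x_{T\cup\{\alpha\}}\in C$ for every nonempty $T\subseteq\{1,\dots,\alpha-1\}$ with $T\cap S\ne\varnothing$.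
   Context: For $\alpha\ge2$, the graph $A_\alpha$ has vertex set consisting of: a vertex $d_\alpha$; a vertex $d_S$ for every nonempty $S\subseteq\{1,\dots,\alpha-1\}$; and a vertex $x_S$ for every $S\subseteq\{1,\dots,\alpha\}$ with $|S|\ge2$. Its edges are: $d_\alpha x_S$ for every $S\subseteq\{1,\dots,\alpha\}$ with $\alpha\in S$ and $|S|\ge2$; $d_Sx_T$ for every nonempty $S\subseteq\{1,\dots,\alpha-1\}$ and every $T\subseteq\{1,\dots,\alpha\}$ with $|T|\ge2$ and $S\cap T\ne\varnothing$; and $x_Sx_T$ for every pair of distinct $S,T\subseteq\{1,\dots,\alpha\}$ with $|S|,|T|\ge2$ and $S\cap T\ne\varnothing$. For vertex sets $A,B$ of a graph $G$, an $A$-$B$ cut is a set $C\subseteq V(G)$ such that $G\setminus C$ contains no path from $A\setminus C$ to $B\setminus C$; it is minimal if for every $x\in C$, $C\setminus\{x\}$ is not an $A$-$B$ cut. A $d_\alpha$-$D_\alpha$ cut means a $\{d_\alpha\}$-$D_\alpha$ cut. -}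

module Defs where

open import Data.Nat using (ℕ; suc; _≤_)
open import Data.Bool using (Bool; true; false; if_then_else_)
open import Data.Bool.Properties using () renaming (_≟_ to _≟B_)
open import Data.Fin.Subset using (Subset; inside; outside; _∩_; Nonempty; ∣_∣)
open import Data.Vec.Properties using (≡-dec)
open import Data.Product using (_×_; Σ)
open import Data.Sum using (_⊎_)
open import Data.Unit using (⊤)
open import Data.Vec using (_∷_; head)
open import Relation.Nullary using (¬_; Dec; yes; no)
open import Relation.Nullary.Decidable using (⌊_⌋)
open import Relation.Binary.PropositionalEquality using (_≡_; _≢_; refl; cong)

-- Encoding of A_α with α = suc m (so α ≥ 2 ⇔ 1 ≤ m).
-- A subset of {1,…,α} is a  Subset (suc m) : the head (index zero) encodes
-- the element α, and index (suc i) encodes the element i+1 ∈ {1,…,α-1}.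
-- A subset S ⊆ {1,…,α-1} is a  Subset m ; it sits inside {1,…,α} as
-- (outside ∷ S), and S ∪ {α} is (inside ∷ S).

-- Raw vertex labels; the vertex set of A_α is the set of Valid labels.
data Vertex (m : ℕ) : Set where
  dα : Vertex m
  d  : Subset m → Vertex m
  x  : Subset (suc m) → Vertex m

Valid : ∀ {m} → Vertex m → Set
Valid dα    = ⊤
Valid (d S) = Nonempty S
Valid (x S) = 2 ≤ ∣ S ∣

data Edge {m : ℕ} : Vertex m → Vertex m → Set where
  dα-x : (S : Subset (suc m)) → head S ≡ inside → 2 ≤ ∣ S ∣ →
         Edge dα (x S)
  d-x  : (S : Subset m) (T : Subset (suc m)) → Nonempty S → 2 ≤ ∣ T ∣ →
         Nonempty ((outside ∷ S) ∩ T) → Edge (d S) (x T)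
  x-x  : (S T : Subset (suc m)) → S ≢ T → 2 ≤ ∣ S ∣ → 2 ≤ ∣ T ∣ →
         Nonempty (S ∩ T) → Edge (x S) (x T)

Adj : ∀ {m} → Vertex m → Vertex m → Set
Adj u v = Edge u v ⊎ Edge v u

VSet : ℕ → Set
VSet m = Vertex m → Bool

data Path {m : ℕ} (C : VSet m) : Vertex m → Vertex m → Set where
  here : ∀ {v} → Valid v → C v ≡ false → Path C v v
  step : ∀ {u v w} → Valid u → C u ≡ false → Adj u v → Path C v w →
         Path C u w

InD : ∀ {m} → Vertex m → Set
InD {m} v = Σ (Subset m) (λ S → Nonempty S × v ≡ d S)

IsCut : ∀ {m} → VSet m → Set
IsCut {m} C = (∀ v → C v ≡ true → Valid v) ×
              (∀ w → InD w → ¬ Path C dα w)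

_≟V_ : ∀ {m} (u v : Vertex m) → Dec (u ≡ v)
dα ≟V dα = yes refl
dα ≟V d _ = no (λ ())
dα ≟V x _ = no (λ ())
d _ ≟V dα = no (λ ())
d S ≟V d T with ≡-dec _≟B_ S T
... | yes refl = yes refl
... | no ne = no (λ { refl → ne refl })
d _ ≟V x _ = no (λ ())
x _ ≟V dα = no (λ ())
x _ ≟V d _ = no (λ ())
x S ≟V x T with ≡-dec _≟B_ S T
... | yes refl = yes refl
... | no ne = no (λ { refl → ne refl })

remove : ∀ {m} → Vertex m → VSet m → VSet m
remove v C w = if ⌊ w ≟V v ⌋ then false else C w

IsMinimalCut : ∀ {m} → VSet m → Set
IsMinimalCut C = IsCut C × (∀ v → C v ≡ true → ¬ IsCut (remove v C))

singleton-dα : ∀ {m} → VSet m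
singleton-dα w = ⌊ w ≟V dα ⌋

module Submission where

-- Write "reachable" for vertices joined to d_α in A_α ∖ C and
-- "escaping" for vertices joined to D_α in A_α ∖ C; a cut means no vertex
-- is both.  Two general facts about a minimal cut C drive everything:
--   * d_α ∉ C, since otherwise minimality forces C = {d_α};
--   * every v ∈ C other than d_α has a reachable neighbour, and every
--     v ∈ C outside D_α has an escaping neighbour (otherwise C ∖ {v} would
--     still be a cut).
-- The graph A_α then supplies three propagation rules for reachability:
-- x_{T∪{α}} ∉ C is reachable (it is adjacent to d_α); a reachable x_Q makes
-- every x_P ∉ C with P ∩ Q ≠ ∅ reachable; and a reachable x_Q forces
-- d_W ∈ C whenever W ∩ Q ≠ ∅.  Parts (c) and (d, ⇒) follow directly from
-- these rules; parts (a), (b) and (d, ⇐) argue by contradiction, taking a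
-- vertex of C and showing that its reachable or escaping neighbour would
-- connect d_α to D_α.

open import Defs
open import Data.Nat using (ℕ; suc; _≤_; z≤n; s≤s)
open import Data.Nat.Properties using (≤-trans)
open import Data.Bool using (true; false)
open import Data.Fin using (Fin; zero; suc)
open import Data.Fin.Subset using (Subset; inside; outside; _∩_; _⊆_; Nonempty; ∣_∣; _∈_; ⁅_⁆)
open import Data.Fin.Subset.Properties using (x∈p∩q⁺; x∈p∩q⁻; x∈⁅x⁆; x∈⁅y⁆⇒x≡y; ∣p∣≤∣x∷p∣)
open import Data.Vec using (_∷_; here; there; head)
open import Data.Vec.Properties using (≡-dec)
open import Data.Bool.Properties using () renaming (_≟_ to _≟B_)
open import Data.Product using (_×_; Σ; _,_; proj₁; proj₂)
open import Data.Sum using (_⊎_; inj₁; inj₂)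
open import Data.Unit using (tt)
open import Data.Empty using (⊥; ⊥-elim)
open import Relation.Nullary using (¬_; yes; no)
open import Relation.Binary.PropositionalEquality using (_≡_; _≢_; refl; sym; trans)
open import Function.Bundles using (_⇔_; mk⇔)

nonempty⇒1≤∣S∣ : ∀ {n} (S : Subset n) {i} → i ∈ S → 1 ≤ ∣ S ∣
nonempty⇒1≤∣S∣ (inside ∷ S) here = s≤s z≤n
nonempty⇒1≤∣S∣ (s ∷ S) (there p) = ≤-trans (nonempty⇒1≤∣S∣ S p) (∣p∣≤∣x∷p∣ s S)

apex-valid : ∀ {n} (S : Subset n) → Nonempty S → 2 ≤ ∣ inside ∷ S ∣
apex-valid S (_ , i∈S) = s≤s (nonempty⇒1≤∣S∣ S i∈S)

∈-shifted : ∀ {n} {j : Fin (suc n)} {T : Subset n} → j ∈ (outside ∷ T) →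
  Σ (Fin n) λ k → j ≡ suc k × k ∈ T
∈-shifted (there k∈T) = _ , refl , k∈T

α∈⇒head : ∀ {n} {P : Subset (suc n)} → zero ∈ P → head P ≡ inside
α∈⇒head here = refl

remove-⊆ : ∀ {m} (v u : Vertex m) (C : VSet m) → remove v C u ≡ true → C u ≡ true
remove-⊆ v u C r with u ≟V v
remove-⊆ v u C () | yes _
... | no _ = r

remove-other : ∀ {m} {v u : Vertex m} (C : VSet m) → u ≢ v → remove v C u ≡ false → C u ≡ false
remove-other {v = v} {u} C u≢v r with u ≟V v
... | yes u≡v = ⊥-elim (u≢v u≡v)
... | no _ = r

Reachable : ∀ {m} → VSet m → Vertex m → Set
Reachable C v = Path C dα v

Escapes : ∀ {m} → VSet m → Vertex m → Set
Escapes {m} C v = Σ (Vertex m) λ w → InD w × Path C v w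

module Paths {m : ℕ} (C : VSet m) where

  start-free : ∀ {a b} → Path C a b → Valid a × C a ≡ false
  start-free (here va ca) = va , ca
  start-free (step va ca _ _) = va , ca

  end-free : ∀ {a b} → Path C a b → Valid b × C b ≡ false
  end-free (here vb cb) = vb , cb
  end-free (step _ _ _ p) = end-free p

  extend : ∀ {a b c} → Path C a b → Adj b c → Valid c → C c ≡ false → Path C a c
  extend (here va ca) b~c vc cc = step va ca b~c (here vc cc)
  extend (step va ca a~a' p) b~c vc cc = step va ca a~a' (extend p b~c vc cc)

  _++_ : ∀ {a b c} → Path C a b → Path C b c → Path C a c
  here _ _ ++ q = q
  step va ca a~a' p ++ q = step va ca a~a' (p ++ q)

  first-visit : ∀ {v a w} → Path (remove v C) a w →
    Path C a w ⊎ (a ≡ v ⊎ Σ (Vertex m) λ u → Path C a u × Adj u v)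
  first-visit {v} (here {a} va ra) with a ≟V v
  ... | yes a≡v = inj₂ (inj₁ a≡v)
  ... | no _ = inj₁ (here va ra)
  first-visit {v} (step {a} va ra a~b p) with a ≟V v
  ... | yes a≡v = inj₂ (inj₁ a≡v)
  ... | no _ with first-visit p
  ...   | inj₁ q = inj₁ (step va ra a~b q)
  ...   | inj₂ (inj₁ refl) = inj₂ (inj₂ (a , here va ra , a~b))
  ...   | inj₂ (inj₂ (u , q , u~v)) = inj₂ (inj₂ (u , step va ra a~b q , u~v))

  last-visit : ∀ {v a w} → Path (remove v C) a w →
    Path C a w ⊎ (w ≡ v ⊎ Σ (Vertex m) λ y → Adj v y × Path C y w)
  last-visit {v} (here {a} va ra) with a ≟V v
  ... | yes a≡v = inj₂ (inj₁ a≡v)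
  ... | no _ = inj₁ (here va ra)
  last-visit {v} (step {a} {b} va ra a~b p) with last-visit p
  ... | inj₂ r = inj₂ r
  ... | inj₁ q with a ≟V v
  ...   | yes refl = inj₂ (inj₂ (b , a~b , q))
  ...   | no _ = inj₁ (step va ra a~b q)

not-in : ∀ {m} (C : VSet m) {v} → (C v ≡ true → ⊥) → C v ≡ false
not-in C {v} h with C v
... | false = refl
... | true = ⊥-elim (h refl)

in-set : ∀ {m} (C : VSet m) {v} → (C v ≡ false → ⊥) → C v ≡ true
in-set C {v} h with C v
... | true = refl
... | false = ⊥-elim (h refl)

remove-cut : ∀ {m} {C : VSet m} (v : Vertex m) → IsCut C →
  (∀ w → InD w → ¬ Path (remove v C) dα w) → IsCut (remove v C)
remove-cut {C = C} v cut separates = (λ u r → proj₁ cut u (remove-⊆ v u C r)) , separates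

module Cut {m : ℕ} {C : VSet m} (cut : IsCut C) where
  open Paths C

  escape-free : ∀ {v} → Escapes C v → Valid v × C v ≡ false
  escape-free (_ , _ , e) = start-free e

  not-both : ∀ {v} → Reachable C v → Escapes C v → ⊥
  not-both r (w , w∈D , e) = proj₂ cut w w∈D (r ++ e)

  not-adjacent : ∀ {u y} → Reachable C u → Adj u y → Escapes C y → ⊥
  not-adjacent r u~y esc =
    not-both (extend r u~y (proj₁ (escape-free esc)) (proj₂ (escape-free esc))) esc

-- Every vertex of a minimal cut is needed: removing it opens a path from
-- d_α to D_α, which must enter it from a reachable vertex and leave it
-- towards an escaping one.  (Stated negatively, as minimality is.)
module MinimalCut {m : ℕ} {C : VSet m} (minimal : IsMinimalCut C) where
  open Paths C

  cut : IsCut C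
  cut = proj₁ minimal

  reachable-neighbour : ∀ {v} → C v ≡ true → dα ≢ v →
    (∀ {u} → Reachable C u → Adj u v → ⊥) → ⊥
  reachable-neighbour {v} v∈C dα≢v isolated =
    proj₂ minimal v v∈C (remove-cut v cut λ w w∈D p → entered w∈D (first-visit p))
    where
    entered : ∀ {w} → InD w →
      Path C dα w ⊎ (dα ≡ v ⊎ Σ (Vertex m) λ u → Path C dα u × Adj u v) → ⊥
    entered w∈D (inj₁ q) = proj₂ cut _ w∈D q
    entered _ (inj₂ (inj₁ dα≡v)) = dα≢v dα≡v
    entered _ (inj₂ (inj₂ (_ , q , u~v))) = isolated q u~v

  escaping-neighbour : ∀ {v} → C v ≡ true → ¬ InD v →
    (∀ {y} → Adj v y → Escapes C y → ⊥) → ⊥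
  escaping-neighbour {v} v∈C v∉D isolated =
    proj₂ minimal v v∈C (remove-cut v cut λ w w∈D p → left w∈D (last-visit p))
    where
    left : ∀ {w} → InD w →
      Path C dα w ⊎ (w ≡ v ⊎ Σ (Vertex m) λ y → Adj v y × Path C y w) → ⊥
    left w∈D (inj₁ q) = proj₂ cut _ w∈D q
    left w∈D (inj₂ (inj₁ refl)) = v∉D w∈D
    left w∈D (inj₂ (inj₂ (_ , v~y , q))) = isolated v~y (_ , w∈D , q)

  -- If d_α ∈ C, no path can start, so every other vertex is redundant.
  others-redundant : C dα ≡ true → ∀ w → w ≢ dα → C w ≡ false
  others-redundant dα∈C w w≢dα = not-in C λ w∈C →
    proj₂ minimal w w∈C (remove-cut w cut λ _ _ p → blocked (Paths.start-free (remove w C) p))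
    where
    blocked : Valid {m} dα × remove w C dα ≡ false → ⊥
    blocked (_ , r) with trans (sym dα∈C) (remove-other C (λ dα≡w → w≢dα (sym dα≡w)) r)
    ... | ()

  dα∉C : ¬ (∀ w → C w ≡ singleton-dα w) → C dα ≡ false
  dα∉C not-singleton = not-in C λ dα∈C → not-singleton (is-singleton dα∈C)
    where
    is-singleton : C dα ≡ true → ∀ w → C w ≡ singleton-dα w
    is-singleton dα∈C dα = dα∈C
    is-singleton dα∈C (d S) = others-redundant dα∈C (d S) (λ ())
    is-singleton dα∈C (x S) = others-redundant dα∈C (x S) (λ ())

module Reachability {m : ℕ} {C : VSet m} (cut : IsCut C) (dα∉C : C dα ≡ false) where
  open Paths C
  open Cut cut

  apex-reachable : ∀ {P} → head P ≡ inside → 2 ≤ ∣ P ∣ → C (x P) ≡ false → Reachable C (x P)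
  apex-reachable α∈P vP cP = step tt dα∉C (inj₁ (dα-x _ α∈P vP)) (here vP cP)

  spread : ∀ {Q P} → Reachable C (x Q) → 2 ≤ ∣ P ∣ → C (x P) ≡ false →
    Nonempty (Q ∩ P) → Reachable C (x P)
  spread {Q} {P} r vP cP Q∩P with ≡-dec _≟B_ Q P
  ... | yes refl = r
  ... | no Q≢P = extend r (inj₁ (x-x Q P Q≢P (proj₁ (end-free r)) vP Q∩P)) vP cP

  d-blocked : ∀ {Q W k} → Reachable C (x Q) → Nonempty W → C (d W) ≡ false →
    suc k ∈ Q → k ∈ W → ⊥
  d-blocked {Q} {W} {k} r neW cW k∈Q k∈W =
    not-adjacent r (inj₂ (d-x W Q neW (proj₁ (end-free r)) (suc k , x∈p∩q⁺ (there k∈W , k∈Q))))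
      (d W , (W , neW , refl) , here neW cW)

  d-entry : ∀ {u T} → Reachable C u → Adj u (d T) →
    Σ (Subset (suc m)) λ Q → Σ (Fin m) λ k → Reachable C (x Q) × suc k ∈ Q × k ∈ T
  d-entry r (inj₁ ())
  d-entry r (inj₂ (d-x T Q _ _ (j , j∈T∩Q))) with x∈p∩q⁻ (outside ∷ T) Q j∈T∩Q
  ... | j∈T , j∈Q with ∈-shifted j∈T
  ... | k , refl , k∈T = Q , k , r , j∈Q , k∈T

  -- An x_P meeting T ∪ {α} cannot escape when a reachable x_Q contains T:
  -- it is reachable itself, from d_α if α ∈ P and from x_Q otherwise.
  x-exit : ∀ {Q T P j} → Reachable C (x Q) → (∀ {k} → k ∈ T → suc k ∈ Q) →
    j ∈ (inside ∷ T) → j ∈ P → Escapes C (x P) → ⊥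
  x-exit r T⊆Q here α∈P esc =
    not-both (apex-reachable (α∈⇒head α∈P) (proj₁ (escape-free esc)) (proj₂ (escape-free esc))) esc
  x-exit r T⊆Q (there k∈T) k∈P esc =
    not-both (spread r (proj₁ (escape-free esc)) (proj₂ (escape-free esc))
                     (_ , x∈p∩q⁺ (T⊆Q k∈T , k∈P))) esc

  -- Leaving x_{T∪{α}} is impossible when a reachable x_Q contains T:
  -- each neighbour is d_α, or a d_W meeting T, or an x_P meeting T ∪ {α},
  -- and in every case the neighbour is reachable or blocked.
  apex-exit : ∀ {Q T y} → Reachable C (x Q) → (∀ {k} → k ∈ T → suc k ∈ Q) →
    Adj (x (inside ∷ T)) y → Escapes C y → ⊥
  apex-exit {T = T} r T⊆Q (inj₁ (x-x _ P _ _ _ (j , jm))) esc with x∈p∩q⁻ (inside ∷ T) P jm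
  ... | j∈T , j∈P = x-exit r T⊆Q j∈T j∈P esc
  apex-exit r T⊆Q (inj₂ (dα-x _ _ _)) esc = not-both (here tt dα∉C) esc
  apex-exit {T = T} r T⊆Q (inj₂ (d-x W _ neW _ (j , jm))) esc
    with x∈p∩q⁻ (outside ∷ W) (inside ∷ T) jm
  ... | j∈W , j∈T with ∈-shifted j∈W
  ... | k , refl , k∈W with j∈T
  ... | there k∈T = d-blocked r neW (proj₂ (escape-free esc)) (T⊆Q k∈T) k∈W
  apex-exit {T = T} r T⊆Q (inj₂ (x-x P _ _ _ _ (j , jm))) esc with x∈p∩q⁻ P (inside ∷ T) jm
  ... | j∈P , j∈T = x-exit r T⊆Q j∈T j∈P esc

module Parts {m : ℕ} {C : VSet m} (minimal : IsMinimalCut C) (dα∉C : C dα ≡ false) where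
  open MinimalCut minimal using (cut; reachable-neighbour; escaping-neighbour)
  open Reachability cut dα∉C

  apex∉D : ∀ {T} → ¬ InD {m} (x (inside ∷ T))
  apex∉D (_ , _ , ())

  -- (a) d_T ∈ C would need a reachable neighbour x_Q meeting T ⊆ S,
  --     and that x_Q would block d_S.
  part-a : ∀ S → Nonempty S → C (d S) ≡ false → ∀ T → T ⊆ S → C (d T) ≡ false
  part-a S neS dS∉C T T⊆S = not-in C λ dT∈C → reachable-neighbour dT∈C (λ ()) entry
    where
    entry : ∀ {u} → Reachable C u → Adj u (d T) → ⊥
    entry r u~dT with d-entry r u~dT
    ... | _ , _ , rQ , k∈Q , k∈T = d-blocked rQ neS dS∉C k∈Q (T⊆S k∈T)

  -- (b) x_{T∪{α}} ∈ C would need an escaping neighbour, but the reachable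
  --     x_{S∪{α}} contains T.
  part-b : ∀ S → Nonempty S → C (x (inside ∷ S)) ≡ false →
    ∀ T → T ⊆ S → C (x (inside ∷ T)) ≡ false
  part-b S neS xS∉C T T⊆S = not-in C λ xT∈C →
    escaping-neighbour xT∈C apex∉D (apex-exit (apex-reachable refl (apex-valid S neS) xS∉C) (λ k∈T → there (T⊆S k∈T)))

  -- (c) x_R ∉ C would be reached from x_{T∪{α}} and would block d_S.
  part-c : ∀ S → Nonempty S → C (d S) ≡ false →
    ∀ T → Nonempty T → C (x (inside ∷ T)) ≡ false →
    ∀ R → Nonempty (R ∩ S) → Nonempty (R ∩ T) → 2 ≤ ∣ R ∣ → C (x (outside ∷ R)) ≡ true
  part-c S neS dS∉C T neT xT∉C R (k , k∈R∩S) (i , i∈R∩T) vR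
    with x∈p∩q⁻ R S k∈R∩S | x∈p∩q⁻ R T i∈R∩T
  ... | k∈R , k∈S | i∈R , i∈T = in-set C λ xR∉C →
    d-blocked (spread (apex-reachable refl (apex-valid T neT) xT∉C) vR xR∉C
                      (suc i , x∈p∩q⁺ (there {y = inside} i∈T , there {y = outside} i∈R)))
              neS dS∉C (there k∈R) k∈S

  -- (d, ⇒) x_{T∪{α}} ∉ C would be reachable and would block d_S.
  part-d⇒ : ∀ S → Nonempty S → C (d S) ≡ false →
    ∀ T → Nonempty T → Nonempty (T ∩ S) → C (x (inside ∷ T)) ≡ true
  part-d⇒ S neS dS∉C T neT (k , k∈T∩S) with x∈p∩q⁻ T S k∈T∩S
  ... | k∈T , k∈S = in-set C λ xT∉C →
    d-blocked (apex-reachable refl (apex-valid T neT) xT∉C) neS dS∉C (there k∈T) k∈S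

  -- (d, ⇐) d_S ∈ C would need a reachable neighbour x_Q, Q ∋ k ∈ S; then
  --     x_{{k,α}} ∈ C would need an escaping neighbour, but x_Q contains k.
  part-d⇐ : ∀ S → (∀ T → Nonempty T → Nonempty (T ∩ S) → C (x (inside ∷ T)) ≡ true) →
    C (d S) ≡ false
  part-d⇐ S apexes∈C = not-in C λ dS∈C → reachable-neighbour dS∈C (λ ()) entry
    where
    entry : ∀ {u} → Reachable C u → Adj u (d S) → ⊥
    entry r u~dS with d-entry r u~dS
    ... | Q , k , rQ , k∈Q , k∈S =
      escaping-neighbour (apexes∈C ⁅ k ⁆ (k , x∈⁅x⁆ k) (k , x∈p∩q⁺ (x∈⁅x⁆ k , k∈S))) apex∉D
        (apex-exit rQ ⁅k⁆⊆Q)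
      where
      ⁅k⁆⊆Q : ∀ {j} → j ∈ ⁅ k ⁆ → suc j ∈ Q
      ⁅k⁆⊆Q j∈⁅k⁆ with x∈⁅y⁆⇒x≡y k j∈⁅k⁆
      ... | refl = k∈Q

lemma2p2 : (m : ℕ) → 1 ≤ m → (C : VSet m) → IsMinimalCut C →
    ¬ (∀ w → C w ≡ singleton-dα w) →
    (S : Subset m) → Nonempty S →
      ((C (d S) ≡ false → ∀ (T : Subset m) → Nonempty T → T ⊆ S →
          C (d T) ≡ false)
      × (C (x (inside ∷ S)) ≡ false → ∀ (T : Subset m) → Nonempty T → T ⊆ S →
          C (x (inside ∷ T)) ≡ false)
      × (C (d S) ≡ false →
          ∀ (T : Subset m) → Nonempty T → C (x (inside ∷ T)) ≡ false →
          ∀ (R : Subset m) → Nonempty (R ∩ S) → Nonempty (R ∩ T) → 2 ≤ ∣ R ∣ →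
            C (x (outside ∷ R)) ≡ true)
      × (C (d S) ≡ false ⇔
          (∀ (T : Subset m) → Nonempty T → Nonempty (T ∩ S) →
            C (x (inside ∷ T)) ≡ true)))
lemma2p2 m _ C minimal not-singleton S neS =
    (λ dS∉C T _ → part-a S neS dS∉C T)
  , (λ xS∉C T _ → part-b S neS xS∉C T)
  , part-c S neS
  , mk⇔ (part-d⇒ S neS) (part-d⇐ S)
  where
  open Parts minimal (MinimalCut.dα∉C minimal not-singleton)
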